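{- Let $\mathbb T=(H_1,v_1,w_1,\alpha_1,\beta_1,H_2,v_2,w_2,\alpha_2,\beta_2)$ and $\mathbb T'=(H_1',v_1',w_1',\alpha_1',\beta_1',H_2',v_2',w_2',\alpha_2',\beta_2')$ be compatible quad-templates. Let $(G_1,\Sigma_1),(G_2,\Sigma_2)$ be quad siblings arising from $\mathbb T$ and $(G_1',\Sigma_1'),(G_2',\Sigma_2')$ quad siblings arising from $\mathbb T'$. Then $(G_i,\Sigma_i)$ and $(G_i',\Sigma_i')$ are equivalent for $i=1,2$.
   Context: Graphs are finite with possible loops and parallel edges; $\operatorname{loops}(H)$ is the set of loops; $\delta_H(U)$ = edges with exactly one end in $U$ (a cut), $\delta_H(v)=\delta_H(\{v\})$. A cycle is an edge set inducing even degrees. Graphs are equivalent if related by Whitney-flips (equivalently same cycles, equivalently same cuts). $\operatorname{ecycle}(G,\Sigma)$: binary matroid whose cycles are the cycles $C$ with $|C\cap\Sigma|$ even. Signed graphs are equivalent if the graphs are equivalent and the signatures differ by a cut. Splitting $v$ into $v^-,v^+$ according to $\alpha\subseteq\delta_H(v)\cup\operatorname{loops}(H)$: loops in $\alpha$ become edges $(v^-,v^+)$, edges of $\delta_H(v)\cap\alpha$ are moved to $v^-$, edges of $\delta_H(v)-\alpha$ to $v^+$, others unchanged. Unfolding $H$ according to distinct vertices $v,w$ and $\alpha\subseteq\delta_H(v)\cup\operatorname{loops}(H)$, $\beta\subseteq\delta_H(w)\cup\operatorname{loops}(H)$ with $\alpha\cap\beta\cap\operatorname{loops}(H)=\emptyset$: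 split $v$ into $v^-,v^+$ according to $\alpha$, then $w$ into $w^-,w^+$ according to $\beta$. A quad-template is $(H_1,v_1,w_1,\alpha_1,\beta_1,H_2,v_2,w_2,\alpha_2,\beta_2)$ with $H_1,H_2$ equivalent, $v_i,w_i$ distinct vertices of $H_i$, $\alpha_i,\beta_i$ as in unfolding, $(\alpha_1\triangle\beta_1)\triangle(\alpha_2\triangle\beta_2)$ a cut of $H_1$, and such that the graphs $G_i$ obtained by unfolding $H_i$ according to $v_i,w_i,\alpha_i,\beta_i$ are inequivalent; signed graphs $(G_1,\Sigma_1),(G_2,\Sigma_2)$ with these $G_i$ and $\operatorname{ecycle}(G_1,\Sigma_1)=\operatorname{ecycle}(G_2,\Sigma_2)$ are the quad siblings arising from it. Quad-templates $\mathbb T,\mathbb T'$ as in the claim are compatible if, for $i=1,2$, $H_i$ is equivalent to $H_i'$, and $\alpha_i\triangle\alpha_i'$ and $\beta_i\triangle\beta_i'$ are cuts of $H_1$. -}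

module Defs where

open import Data.Bool using (Bool; true; false; _∧_; _∨_; not; _xor_; if_then_else_)
open import Data.Nat using (ℕ; zero; suc; _+_)
open import Data.Nat.Divisibility using (_∣_)
open import Data.Fin using (Fin; zero; suc; inject₁; fromℕ; _≟_)
open import Data.Product using (_×_; ∃)
open import Data.Sum using (_⊎_)
open import Relation.Binary.PropositionalEquality using (_≡_; _≢_)
open import Relation.Nullary using (¬_)
open import Relation.Nullary.Decidable using (⌊_⌋)
open import Function.Bundles using (_⇔_)

-- All graphs compared in the statement share the
-- common edge set Fin m (equivalence of graphs presupposes the same edges).
record Graph (n m : ℕ) : Set where
  field
    src tgt : Fin m → Fin n
open Graph public

EdgeSet : ℕ → Set
EdgeSet m = Fin m → Bool

_△_ : ∀ {m} → EdgeSet m → EdgeSet m → EdgeSet m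
(X △ Y) e = X e xor Y e

_∩_ : ∀ {m} → EdgeSet m → EdgeSet m → EdgeSet m
(X ∩ Y) e = X e ∧ Y e

count : ∀ {m} → EdgeSet m → ℕ
count {zero}  X = 0
count {suc m} X = (if X zero then 1 else 0) + count (λ e → X (suc e))

Even : ℕ → Set
Even k = 2 ∣ k

_==_ : ∀ {n} → Fin n → Fin n → Bool
x == y = ⌊ x ≟ y ⌋

loops : ∀ {n m} → Graph n m → EdgeSet m
loops H e = src H e == tgt H e

δ : ∀ {n m} → Graph n m → (Fin n → Bool) → EdgeSet m
δ H U e = U (src H e) xor U (tgt H e)

δv : ∀ {n m} → Graph n m → Fin n → EdgeSet m
δv H v = δ H (λ x → x == v)

IsCut : ∀ {n m} → Graph n m → EdgeSet m → Set
IsCut {n} H X = ∃ λ (U : Fin n → Bool) → ∀ e → X e ≡ δ H U e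

-- degree of v in the subgraph with edge set C (a loop counts twice)
degree : ∀ {n m} → Graph n m → EdgeSet m → Fin n → ℕ
degree H C v = count (λ e → C e ∧ (src H e == v)) + count (λ e → C e ∧ (tgt H e == v))

IsCycle : ∀ {n m} → Graph n m → EdgeSet m → Set
IsCycle H C = ∀ v → Even (degree H C v)

GEquiv : ∀ {n n' m} → Graph n m → Graph n' m → Set
GEquiv H H' = ∀ C → IsCycle H C ⇔ IsCycle H' C

Admissible : ∀ {n m} → Graph n m → Fin n → EdgeSet m → Set
Admissible H v α = ∀ e → α e ≡ true → (δv H v e ≡ true) ⊎ (loops H e ≡ true)

-- splitting v into v⁻ = inject₁ v and v⁺ = fromℕ n according to α
split : ∀ {n m} → Graph n m → Fin n → EdgeSet m → Graph (suc n) m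
split {n} H v α = record { src = s ; tgt = t }
  where
    vm vp : Fin (suc n)
    vm = inject₁ v
    vp = fromℕ n
    end : Fin _ → Fin n → Fin (suc n)
    end e x = if (x == v) ∧ δv H v e ∧ not (α e) then vp else inject₁ x
    s t : Fin _ → Fin (suc n)
    s e = if α e ∧ loops H e then vm else end e (src H e)
    t e = if α e ∧ loops H e then vp else end e (tgt H e)

unfold : ∀ {n m} → Graph n m → Fin n → Fin n → EdgeSet m → EdgeSet m → Graph (suc (suc n)) m
unfold H v w α β = split (split H v α) (inject₁ w) β

-- equal even-cycle matroids: ecycle(G,Σ) = ecycle(G',Σ')
SameEcycle : ∀ {n n' m} → Graph n m → EdgeSet m → Graph n' m → EdgeSet m → Set
SameEcycle G Σ G' Σ' =
  ∀ C → (IsCycle G C × Even (count (C ∩ Σ))) ⇔ (IsCycle G' C × Even (count (C ∩ Σ')))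

SEquiv : ∀ {n n' m} → Graph n m → EdgeSet m → Graph n' m → EdgeSet m → Set
SEquiv G Σ G' Σ' = GEquiv G G' × IsCut G (Σ △ Σ')

record QuadTemplate (m : ℕ) : Set where
  field
    n₁ n₂ : ℕ
    H₁ : Graph n₁ m
    v₁ w₁ : Fin n₁
    α₁ β₁ : EdgeSet m
    H₂ : Graph n₂ m
    v₂ w₂ : Fin n₂
    α₂ β₂ : EdgeSet m
    H₁≈H₂ : GEquiv H₁ H₂
    v₁≢w₁ : v₁ ≢ w₁
    v₂≢w₂ : v₂ ≢ w₂
    α₁-ok : Admissible H₁ v₁ α₁
    β₁-ok : Admissible H₁ w₁ β₁
    α₂-ok : Admissible H₂ v₂ α₂
    β₂-ok : Admissible H₂ w₂ β₂
    αβ₁-loops : ∀ e → (α₁ ∩ (β₁ ∩ loops H₁)) e ≡ false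
    αβ₂-loops : ∀ e → (α₂ ∩ (β₂ ∩ loops H₂)) e ≡ false
    cut : IsCut H₁ ((α₁ △ β₁) △ (α₂ △ β₂))
    inequiv : ¬ GEquiv (unfold H₁ v₁ w₁ α₁ β₁) (unfold H₂ v₂ w₂ α₂ β₂)

  G₁ : Graph (suc (suc n₁)) m
  G₁ = unfold H₁ v₁ w₁ α₁ β₁
  G₂ : Graph (suc (suc n₂)) m
  G₂ = unfold H₂ v₂ w₂ α₂ β₂

open QuadTemplate public

QuadSiblings : ∀ {m} → QuadTemplate m → EdgeSet m → EdgeSet m → Set
QuadSiblings T Σ₁ Σ₂ = SameEcycle (G₁ T) Σ₁ (G₂ T) Σ₂

Compatible : ∀ {m} → QuadTemplate m → QuadTemplate m → Set
Compatible T T' =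
  GEquiv (H₁ T) (H₁ T') × GEquiv (H₂ T) (H₂ T')
  × IsCut (H₁ T) (α₁ T △ α₁ T') × IsCut (H₁ T) (β₁ T △ β₁ T')
  × IsCut (H₁ T) (α₂ T △ α₂ T') × IsCut (H₁ T) (β₂ T △ β₂ T')

-- Over GF(2) a set of edges is a cut exactly when it meets every cycle evenly.
-- Splitting v according to α keeps precisely the cycles of H that meet α evenly,
-- so the cycles of an unfolding depend only on the cycles of H and on α, β up to
-- cuts of H; compatible templates therefore unfold to equivalent graphs.  For quad
-- siblings, inequivalence of G₁ and G₂ forces every common cycle to be Σ₁-even
-- (an odd one could be added to any odd cycle of G₁ to make G₁ and G₂ equivalent),
-- so a cycle of G₁ is Σ₁-even exactly when it is a cycle of G₂.  Hence Σ₁ and Σ₁'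
-- have the same parity on every cycle of G₁ and differ by a cut.
module Submission where

open import Defs
open import Algebra.Bundles using (CommutativeRing)
open import Data.Bool using (Bool; true; false; _∧_; not; _xor_; if_then_else_)
open import Data.Bool.Properties
  using (xor-∧-commutativeRing; xor-same; xor-identityʳ; xor-assoc; not-distribˡ-xor;
         ∧-distribˡ-xor; ∧-distribʳ-xor; ∧-zeroʳ; ∧-identityʳ; if-eta)
open import Data.Fin using (Fin; zero; suc; inject₁; fromℕ; _≟_)
open import Data.Fin.Properties using (fromℕ≢inject₁; inject₁-injective)
open import Data.Fin.Relation.Unary.Top using (view; ‵fromℕ; ‵inj₁)
open import Data.Nat using (ℕ; zero; suc; _+_; _*_)
open import Data.Nat.Divisibility using (divides)
open import Data.Product using (_×_; _,_; proj₁; proj₂)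
open import Data.Sum using (inj₁; inj₂)
open import Data.Vec.Functional using (_∷_; replicate; tail)
open import Function using (_∘_)
open import Function.Bundles using (_⇔_; mk⇔; Equivalence)
open import Function.Construct.Composition using (_⇔-∘_)
open import Function.Construct.Symmetry using (⇔-sym)
open import Function.Construct.Identity using (⇔-id)
open import Relation.Binary.PropositionalEquality
open import Relation.Nullary using (¬_; yes; no; does; contradiction)
open import Relation.Nullary.Decidable using (isYes; dec-true; dec-false; does-⇔; isYes≗does)

open import Algebra.Properties.Semiring.Sum (CommutativeRing.semiring xor-∧-commutativeRing)
  using (sum; sum-cong-≗; ∑-distrib-+; ∑-comm; *-distribˡ-sum; sum-replicate-zero)
open import Algebra.Properties.CommutativeSemigroup (CommutativeRing.+-commutativeSemigroup xor-∧-commutativeRing)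
  using () renaming (interchange to xor-interchange)
open import Algebra.Properties.CommutativeSemigroup (CommutativeRing.*-commutativeSemigroup xor-∧-commutativeRing)
  using () renaming (x∙yz≈y∙xz to ∧-swapˡ)

open Equivalence using (to; from)
open ≡-Reasoning

==-refl : ∀ {n} (x : Fin n) → x == x ≡ true
==-refl x = trans (isYes≗does (x ≟ x)) (dec-true (x ≟ x) refl)

≢⇒==-false : ∀ {n} {x y : Fin n} → x ≢ y → x == y ≡ false
≢⇒==-false {x = x} {y} x≢y = trans (isYes≗does (x ≟ y)) (dec-false (x ≟ y) x≢y)

==-true⇒≡ : ∀ {n} {x y : Fin n} → x == y ≡ true → x ≡ y
==-true⇒≡ {x = x} {y} eq with x ≟ y
... | yes x≡y = x≡y
==-true⇒≡ () | no _

inject₁-== : ∀ {n} (x y : Fin n) → inject₁ x == inject₁ y ≡ x == y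
inject₁-== x y = begin
  isYes (inject₁ x ≟ inject₁ y)  ≡⟨ isYes≗does (inject₁ x ≟ inject₁ y) ⟩
  does (inject₁ x ≟ inject₁ y)   ≡⟨ does-⇔ inject₁-≡⇔ (inject₁ x ≟ inject₁ y) (x ≟ y) ⟩
  does (x ≟ y)                   ≡⟨ isYes≗does (x ≟ y) ⟨
  isYes (x ≟ y)                  ∎
  where inject₁-≡⇔ = mk⇔ inject₁-injective (cong inject₁)

suc-== : ∀ {n} (x y : Fin n) → suc x == suc y ≡ x == y
suc-== x y = trans (isYes≗does (suc x ≟ suc y)) (sym (isYes≗does (x ≟ y)))

fromℕ-==-inject₁ : ∀ {n} (x : Fin n) → fromℕ n == inject₁ x ≡ false
fromℕ-==-inject₁ x = ≢⇒==-false fromℕ≢inject₁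

inject₁-==-fromℕ : ∀ {n} (x : Fin n) → inject₁ x == fromℕ n ≡ false
inject₁-==-fromℕ x = ≢⇒==-false (fromℕ≢inject₁ ∘ sym)

∧-true⇒ : ∀ {a b} → a ∧ b ≡ true → a ≡ true × b ≡ true
∧-true⇒ {true} {true} _ = refl , refl
∧-true⇒ {false} ()
∧-true⇒ {true} {false} ()

xor-false⇒≡ : ∀ {a b} → a xor b ≡ false → a ≡ b
xor-false⇒≡ {false} eq = sym eq
xor-false⇒≡ {true} {true} _ = refl
xor-false⇒≡ {true} {false} ()

≡⇒xor-false : ∀ {a b} → a ≡ b → a xor b ≡ false
≡⇒xor-false {a} refl = xor-same a

xor-cancelʳ : ∀ a b → (a xor b) xor b ≡ a
xor-cancelʳ a b = trans (xor-assoc a b b) (trans (cong (a xor_) (xor-same b)) (xor-identityʳ a))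

false⇔false⇒≡ : ∀ {a b} → (a ≡ false ⇔ b ≡ false) → a ≡ b
false⇔false⇒≡ {false} a⇔b = sym (to a⇔b refl)
false⇔false⇒≡ {true} {false} a⇔b = from a⇔b refl
false⇔false⇒≡ {true} {true} _ = refl

infix 7 _·_
_·_ : ∀ {m} → EdgeSet m → EdgeSet m → Bool
C · X = sum (C ∩ X)

·-congʳ : ∀ {m} (C : EdgeSet m) {X Y} → (∀ e → X e ≡ Y e) → C · X ≡ C · Y
·-congʳ C X≗Y = sum-cong-≗ (λ e → cong (C e ∧_) (X≗Y e))

·-distribʳ-△ : ∀ {m} (C X Y : EdgeSet m) → C · (X △ Y) ≡ C · X xor C · Y
·-distribʳ-△ C X Y =
  trans (sum-cong-≗ (λ e → ∧-distribˡ-xor (C e) (X e) (Y e))) (∑-distrib-+ (C ∩ X) (C ∩ Y))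

·-distribˡ-△ : ∀ {m} (C D X : EdgeSet m) → (C △ D) · X ≡ C · X xor D · X
·-distribˡ-△ C D X =
  trans (sum-cong-≗ (λ e → ∧-distribʳ-xor (X e) (C e) (D e))) (∑-distrib-+ (C ∩ X) (D ∩ X))

·-singleton : ∀ {m} (X : EdgeSet (suc m)) → (true ∷ replicate m false) · X ≡ X zero
·-singleton {m} X = trans (cong (X zero xor_) (sum-replicate-zero m)) (xor-identityʳ (X zero))

sum-indicator : ∀ {n} (U : Fin n → Bool) (x : Fin n) → sum (λ v → U v ∧ (x == v)) ≡ U x
sum-indicator {suc n} U zero = begin
  (U zero ∧ true) xor sum (λ v → U (suc v) ∧ false)
    ≡⟨ cong₂ _xor_ (∧-identityʳ (U zero)) (sum-cong-≗ (∧-zeroʳ ∘ U ∘ suc)) ⟩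
  U zero xor sum (replicate n false)
    ≡⟨ cong (U zero xor_) (sum-replicate-zero n) ⟩
  U zero xor false
    ≡⟨ xor-identityʳ (U zero) ⟩
  U zero ∎
sum-indicator {suc n} U (suc x) = begin
  (U zero ∧ false) xor sum (λ v → U (suc v) ∧ (suc x == suc v))
    ≡⟨ cong₂ _xor_ (∧-zeroʳ (U zero)) (sum-cong-≗ (λ v → cong (U (suc v) ∧_) (suc-== x v))) ⟩
  sum (λ v → U (suc v) ∧ (x == v))
    ≡⟨ sum-indicator (U ∘ suc) x ⟩
  U (suc x) ∎

odd : ℕ → Bool
odd zero = false
odd (suc zero) = true
odd (suc (suc k)) = odd k

odd-suc : ∀ k → odd (suc k) ≡ not (odd k)
odd-suc zero = refl
odd-suc (suc zero) = refl
odd-suc (suc (suc k)) = odd-suc k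

odd-+ : ∀ a b → odd (a + b) ≡ odd a xor odd b
odd-+ zero b = refl
odd-+ (suc a) b = begin
  odd (suc (a + b))      ≡⟨ odd-suc (a + b) ⟩
  not (odd (a + b))      ≡⟨ cong not (odd-+ a b) ⟩
  not (odd a xor odd b)  ≡⟨ not-distribˡ-xor (odd a) (odd b) ⟩
  not (odd a) xor odd b  ≡⟨ cong (_xor odd b) (odd-suc a) ⟨
  odd (suc a) xor odd b  ∎

odd-*2 : ∀ q → odd (q * 2) ≡ false
odd-*2 zero = refl
odd-*2 (suc q) = odd-*2 q

Even⇔¬odd : ∀ k → Even k ⇔ (odd k ≡ false)
Even⇔¬odd k = mk⇔ (λ { (divides q refl) → odd-*2 q }) (even k)
  where
  even : ∀ k → odd k ≡ false → Even k
  even zero _ = divides 0 refl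
  even (suc (suc k)) odd≡false with even k odd≡false
  ... | divides q refl = divides (suc q) refl

odd-count : ∀ {m} (X : EdgeSet m) → odd (count X) ≡ sum X
odd-count {zero} X = refl
odd-count {suc m} X with X zero
... | true = trans (odd-suc (count (tail X))) (cong not (odd-count (tail X)))
... | false = odd-count (tail X)

Even-count⇔ : ∀ {m} (X : EdgeSet m) → Even (count X) ⇔ (sum X ≡ false)
Even-count⇔ X = mk⇔ (trans (sym (odd-count X))) (trans (odd-count X)) ⇔-∘ Even⇔¬odd (count X)

Cycle : ∀ {n m} → Graph n m → EdgeSet m → Set
Cycle G C = ∀ v → C · δv G v ≡ false

odd-degree : ∀ {n m} (G : Graph n m) C v → odd (degree G C v) ≡ C · δv G v
odd-degree G C v = begin
  odd (count A + count B)          ≡⟨ odd-+ (count A) (count B) ⟩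
  odd (count A) xor odd (count B)  ≡⟨ cong₂ _xor_ (odd-count A) (odd-count B) ⟩
  sum A xor sum B                  ≡⟨ ∑-distrib-+ A B ⟨
  sum (λ e → A e xor B e)          ≡⟨ sum-cong-≗ (λ e → ∧-distribˡ-xor (C e) _ _) ⟨
  C · δv G v                       ∎
  where
  A B : EdgeSet _
  A e = C e ∧ (src G e == v)
  B e = C e ∧ (tgt G e == v)

IsCycle⇔Cycle : ∀ {n m} (G : Graph n m) C → IsCycle G C ⇔ Cycle G C
IsCycle⇔Cycle G C = mk⇔
  (λ even v → trans (sym (odd-degree G C v)) (to (Even⇔¬odd _) (even v)))
  (λ cyc v → from (Even⇔¬odd _) (trans (odd-degree G C v) (cyc v)))

Cycle-cong : ∀ {n m} (G : Graph n m) {C D} → (∀ e → C e ≡ D e) → Cycle G C → Cycle G D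
Cycle-cong G C≗D cyc v = trans (sum-cong-≗ (λ e → cong (_∧ δv G v e) (sym (C≗D e)))) (cyc v)

Cycle-△ : ∀ {n m} (G : Graph n m) {C D} → Cycle G C → Cycle G D → Cycle G (C △ D)
Cycle-△ G {C} {D} cycC cycD v = trans (·-distribˡ-△ C D (δv G v)) (cong₂ _xor_ (cycC v) (cycD v))

Cycle⇔ : ∀ {n n' m} {G : Graph n m} {G' : Graph n' m} → GEquiv G G' → ∀ C → Cycle G C ⇔ Cycle G' C
Cycle⇔ {G = G} {G'} G≈G' C = IsCycle⇔Cycle G' C ⇔-∘ (G≈G' C ⇔-∘ ⇔-sym (IsCycle⇔Cycle G C))

Cycle⇔⇒GEquiv : ∀ {n n' m} {G : Graph n m} {G' : Graph n' m} → (∀ C → Cycle G C ⇔ Cycle G' C) → GEquiv G G'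
Cycle⇔⇒GEquiv {G = G} {G'} same C = ⇔-sym (IsCycle⇔Cycle G' C) ⇔-∘ (same C ⇔-∘ IsCycle⇔Cycle G C)

GEquiv-refl : ∀ {n m} {G : Graph n m} → GEquiv G G
GEquiv-refl C = ⇔-id _

GEquiv-sym : ∀ {n n' m} {G : Graph n m} {G' : Graph n' m} → GEquiv G G' → GEquiv G' G
GEquiv-sym G≈G' C = ⇔-sym (G≈G' C)

δ-loop : ∀ {n m} (G : Graph n m) U {e} → src G e ≡ tgt G e → δ G U e ≡ false
δ-loop G U {e} loop = trans (cong (λ x → U x xor U (tgt G e)) loop) (xor-same (U (tgt G e)))

δ-xor : ∀ {n m} (G : Graph n m) (U V : Fin n → Bool) e → δ G (λ x → U x xor V x) e ≡ δ G U e xor δ G V e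
δ-xor G U V e = xor-interchange (U (src G e)) (V (src G e)) (U (tgt G e)) (V (tgt G e))

δ-sum-stars : ∀ {n m} (G : Graph n m) U e → δ G U e ≡ sum (λ v → U v ∧ δv G v e)
δ-sum-stars G U e = sym (begin
  sum (λ v → U v ∧ δv G v e)
    ≡⟨ sum-cong-≗ (λ v → ∧-distribˡ-xor (U v) (src G e == v) (tgt G e == v)) ⟩
  sum (λ v → (U v ∧ (src G e == v)) xor (U v ∧ (tgt G e == v)))
    ≡⟨ ∑-distrib-+ (λ v → U v ∧ (src G e == v)) (λ v → U v ∧ (tgt G e == v)) ⟩
  sum (λ v → U v ∧ (src G e == v)) xor sum (λ v → U v ∧ (tgt G e == v))
    ≡⟨ cong₂ _xor_ (sum-indicator U (src G e)) (sum-indicator U (tgt G e)) ⟩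
  δ G U e ∎)

-- Every cut is a sum of stars, and cycles are orthogonal to stars.
cut-orthogonal : ∀ {n m} (G : Graph n m) {C} → Cycle G C → ∀ U → C · δ G U ≡ false
cut-orthogonal {n} G {C} cyc U = begin
  sum (λ e → C e ∧ δ G U e)
    ≡⟨ ·-congʳ C (δ-sum-stars G U) ⟩
  sum (λ e → C e ∧ sum (λ v → U v ∧ δv G v e))
    ≡⟨ sum-cong-≗ (λ e → *-distribˡ-sum (C e) (λ v → U v ∧ δv G v e)) ⟩
  sum (λ e → sum (λ v → C e ∧ (U v ∧ δv G v e)))
    ≡⟨ ∑-comm (λ e v → C e ∧ (U v ∧ δv G v e)) ⟩
  sum (λ v → sum (λ e → C e ∧ (U v ∧ δv G v e)))
    ≡⟨ sum-cong-≗ pull-out ⟩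
  sum (λ v → U v ∧ C · δv G v)
    ≡⟨ sum-cong-≗ (λ v → trans (cong (U v ∧_) (cyc v)) (∧-zeroʳ (U v))) ⟩
  sum (replicate n false)
    ≡⟨ sum-replicate-zero n ⟩
  false ∎
  where
  pull-out : ∀ v → sum (λ e → C e ∧ (U v ∧ δv G v e)) ≡ U v ∧ C · δv G v
  pull-out v = trans (sum-cong-≗ (λ e → ∧-swapˡ (C e) (U v) (δv G v e)))
                     (sym (*-distribˡ-sum (U v) (C ∩ δv G v)))

cut-parity-invariant : ∀ {n m} (G : Graph n m) {A A' C} → IsCut G (A △ A') → Cycle G C → C · A ≡ C · A'
cut-parity-invariant G {A} {A'} {C} (U , A△A'≗δU) cyc = xor-false⇒≡ (begin
  C · A xor C · A'  ≡⟨ ·-distribʳ-△ C A A' ⟨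
  C · (A △ A')      ≡⟨ ·-congʳ C A△A'≗δU ⟩
  C · δ G U         ≡⟨ cut-orthogonal G cyc U ⟩
  false             ∎)

OrthogonalToCycles : ∀ {n m} → Graph n m → EdgeSet m → Set
OrthogonalToCycles G X = ∀ C → Cycle G C → C · X ≡ false

OrthogonalIsCut : ℕ → ℕ → Set
OrthogonalIsCut n m = ∀ (G : Graph n m) X → OrthogonalToCycles G X → IsCut G X

delete₀ : ∀ {n m} → Graph n (suc m) → Graph n m
delete₀ G = record { src = src G ∘ suc ; tgt = tgt G ∘ suc }

loop-cycle : ∀ {n m} (G : Graph n (suc m)) → src G zero ≡ tgt G zero → Cycle G (true ∷ replicate m false)
loop-cycle G loop v = trans (·-singleton (δv G v)) (δ-loop G (_== v) loop)

orthogonal⇒cut-loop : ∀ {n m} → OrthogonalIsCut n m →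
  ∀ (G : Graph n (suc m)) → src G zero ≡ tgt G zero → ∀ X → OrthogonalToCycles G X → IsCut G X
orthogonal⇒cut-loop {n} ih G loop X X⊥ = U , X≗δU
  where
  -- false ∷ C is a cycle of G whenever C is one of delete₀ G, by computation
  tail-cut : IsCut (delete₀ G) (tail X)
  tail-cut = ih (delete₀ G) (tail X) (λ C → X⊥ (false ∷ C))
  U : Fin n → Bool
  U = proj₁ tail-cut
  X≗δU : ∀ e → X e ≡ δ G U e
  X≗δU zero = begin
    X zero                             ≡⟨ ·-singleton X ⟨
    (true ∷ replicate _ false) · X     ≡⟨ X⊥ (true ∷ replicate _ false) (loop-cycle G loop) ⟩
    false                              ≡⟨ δ-loop G U loop ⟨
    δ G U zero                         ∎
  X≗δU (suc e) = proj₂ tail-cut e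

module Contraction {n m} (G : Graph n (suc m)) (s≢t : src G zero ≢ tgt G zero) where
  s t : Fin n
  s = src G zero
  t = tgt G zero

  merge : Fin n → Fin n
  merge x = if x == t then s else x

  contract₀ : Graph n m
  contract₀ = record { src = merge ∘ src G ∘ suc ; tgt = merge ∘ tgt G ∘ suc }

  merge-s : merge s ≡ s
  merge-s = if-eta (s == t)

  merge-t : merge t ≡ s
  merge-t = cong (if_then s else t) (==-refl t)

  merge-==-s : ∀ x → merge x == s ≡ (x == t) xor (x == s)
  merge-==-s x with x ≟ t
  ... | yes refl = trans (==-refl s) (sym (cong not (≢⇒==-false (s≢t ∘ sym))))
  ... | no _ = refl

  merge-==-other : ∀ {y} → y ≢ s → y ≢ t → ∀ x → merge x == y ≡ x == y
  merge-==-other y≢s y≢t x with x ≟ t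
  ... | yes refl = trans (≢⇒==-false (y≢s ∘ sym)) (sym (≢⇒==-false (y≢t ∘ sym)))
  ... | no _ = refl

  s-incident : δv G s zero ≡ true
  s-incident = cong₂ _xor_ (==-refl s) (≢⇒==-false (s≢t ∘ sym))

  t-incident : δv G t zero ≡ true
  t-incident = cong₂ _xor_ (≢⇒==-false s≢t) (==-refl t)

  star-s : ∀ i → δv contract₀ s i ≡ δv G t (suc i) xor δv G s (suc i)
  star-s i = trans (cong₂ _xor_ (merge-==-s x) (merge-==-s y)) (xor-interchange (x == t) (x == s) (y == t) (y == s))
    where
    x y : Fin n
    x = src G (suc i)
    y = tgt G (suc i)

  star-other : ∀ {y} → y ≢ s → y ≢ t → ∀ i → δv contract₀ y i ≡ δv G y (suc i)
  star-other y≢s y≢t i =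
    cong₂ _xor_ (merge-==-other y≢s y≢t (src G (suc i))) (merge-==-other y≢s y≢t (tgt G (suc i)))

  t-parity : EdgeSet m → Bool
  t-parity C = C · tail (δv G t)

  -- the first edge is added to C exactly when t has odd degree in C
  lift : EdgeSet m → EdgeSet (suc m)
  lift C = t-parity C ∷ C

  lift-cycle : ∀ {C} → Cycle contract₀ C → Cycle G (lift C)
  lift-cycle {C} cyc y with y ≟ t | y ≟ s
  ... | yes refl | _ = begin
    (t-parity C ∧ δv G t zero) xor t-parity C  ≡⟨ cong (λ d → (t-parity C ∧ d) xor t-parity C) t-incident ⟩
    (t-parity C ∧ true) xor t-parity C         ≡⟨ cong (_xor t-parity C) (∧-identityʳ (t-parity C)) ⟩
    t-parity C xor t-parity C                  ≡⟨ xor-same (t-parity C) ⟩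
    false                                      ∎
  ... | no _ | yes refl = begin
    (t-parity C ∧ δv G s zero) xor C · tail (δv G s)
      ≡⟨ cong (λ d → (t-parity C ∧ d) xor C · tail (δv G s)) s-incident ⟩
    (t-parity C ∧ true) xor C · tail (δv G s)
      ≡⟨ cong (_xor C · tail (δv G s)) (∧-identityʳ (t-parity C)) ⟩
    t-parity C xor C · tail (δv G s)
      ≡⟨ ·-distribʳ-△ C (tail (δv G t)) (tail (δv G s)) ⟨
    C · (tail (δv G t) △ tail (δv G s))
      ≡⟨ ·-congʳ C star-s ⟨
    C · δv contract₀ s
      ≡⟨ cyc s ⟩
    false ∎
  ... | no y≢t | no y≢s = begin
    (t-parity C ∧ δv G y zero) xor C · tail (δv G y)
      ≡⟨ cong (λ d → (t-parity C ∧ d) xor C · tail (δv G y)) y-not-incident ⟩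
    (t-parity C ∧ false) xor C · tail (δv G y)
      ≡⟨ cong (_xor C · tail (δv G y)) (∧-zeroʳ (t-parity C)) ⟩
    C · tail (δv G y)
      ≡⟨ ·-congʳ C (star-other y≢s y≢t) ⟨
    C · δv contract₀ y
      ≡⟨ cyc y ⟩
    false ∎
    where
    y-not-incident : δv G y zero ≡ false
    y-not-incident = cong₂ _xor_ (≢⇒==-false (y≢s ∘ sym)) (≢⇒==-false (y≢t ∘ sym))

-- Shift X by the cut δ(t) so that the first edge s t drops out, then contract it.
orthogonal⇒cut-link : ∀ {n m} → OrthogonalIsCut n m →
  ∀ (G : Graph n (suc m)) → src G zero ≢ tgt G zero → ∀ X → OrthogonalToCycles G X → IsCut G X
orthogonal⇒cut-link {n} ih G s≢t X X⊥ = (λ x → U (merge x) xor W x) , X≗δ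
  where
  open Contraction G s≢t
  W : Fin n → Bool
  W x = X zero ∧ (x == t)
  X₀ : EdgeSet _
  X₀ = X △ δ G W
  X₀⊥ : OrthogonalToCycles G X₀
  X₀⊥ C cyc = trans (·-distribʳ-△ C X (δ G W)) (cong₂ _xor_ (X⊥ C cyc) (cut-orthogonal G {C} cyc W))
  X₀-first : X₀ zero ≡ false
  X₀-first = begin
    X zero xor ((X zero ∧ (s == t)) xor (X zero ∧ (t == t)))
      ≡⟨ cong (X zero xor_) (∧-distribˡ-xor (X zero) (s == t) (t == t)) ⟨
    X zero xor (X zero ∧ δv G t zero)
      ≡⟨ cong (λ d → X zero xor (X zero ∧ d)) t-incident ⟩
    X zero xor (X zero ∧ true)
      ≡⟨ cong (X zero xor_) (∧-identityʳ (X zero)) ⟩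
    X zero xor X zero
      ≡⟨ xor-same (X zero) ⟩
    false ∎
  tail-cut : IsCut contract₀ (tail X₀)
  tail-cut = ih contract₀ (tail X₀) λ C cyc → begin
    C · tail X₀
      ≡⟨ cong (_xor C · tail X₀) (∧-zeroʳ (t-parity C)) ⟨
    (t-parity C ∧ false) xor C · tail X₀
      ≡⟨ cong (λ x → (t-parity C ∧ x) xor C · tail X₀) X₀-first ⟨
    (t-parity C ∧ X₀ zero) xor C · tail X₀
      ≡⟨ X₀⊥ (lift C) (lift-cycle cyc) ⟩
    false ∎
  U : Fin n → Bool
  U = proj₁ tail-cut
  X₀≗δ : ∀ e → X₀ e ≡ δ G (U ∘ merge) e
  X₀≗δ zero = sym (trans (cong₂ (λ x y → U x xor U y) merge-s merge-t) (trans (xor-same (U s)) (sym X₀-first)))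
  X₀≗δ (suc e) = proj₂ tail-cut e
  X≗δ : ∀ e → X e ≡ δ G (λ x → U (merge x) xor W x) e
  X≗δ e = begin
    X e                                   ≡⟨ xor-cancelʳ (X e) (δ G W e) ⟨
    X₀ e xor δ G W e                      ≡⟨ cong (_xor δ G W e) (X₀≗δ e) ⟩
    δ G (U ∘ merge) e xor δ G W e         ≡⟨ δ-xor G (U ∘ merge) W e ⟨
    δ G (λ x → U (merge x) xor W x) e     ∎

orthogonal⇒cut : ∀ {n m} → OrthogonalIsCut n m
orthogonal⇒cut {m = zero} G X _ = (λ _ → false) , λ ()
orthogonal⇒cut {m = suc m} G with src G zero ≟ tgt G zero
... | yes loop = orthogonal⇒cut-loop orthogonal⇒cut G loop
... | no link = orthogonal⇒cut-link orthogonal⇒cut G link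

relocate : ∀ {n} → Bool → Fin n → Fin (suc n)
relocate {n} c x = if c then fromℕ n else inject₁ x

relocate-==-inject₁ : ∀ {n} c (x y : Fin n) → relocate c x == inject₁ y ≡ not c ∧ (x == y)
relocate-==-inject₁ false x y = inject₁-== x y
relocate-==-inject₁ true x y = fromℕ-==-inject₁ y

relocate-==-fromℕ : ∀ {n} c (x : Fin n) → relocate c x == fromℕ n ≡ c
relocate-==-fromℕ false x = inject₁-==-fromℕ x
relocate-==-fromℕ true x = ==-refl (fromℕ _)

-- split H v α puts v⁻ at inject₁ v and v⁺ at fromℕ n; an end x of an edge e
-- that is not a loop in α is moved to v⁺ exactly when `moved x e` holds.
module Splitting {n m} (H : Graph n m) (v : Fin n) (α : EdgeSet m) where
  moved : Fin n → Fin m → Bool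
  moved x e = (x == v) ∧ δv H v e ∧ not (α e)

  loop-in-α : ∀ {e} → α e ∧ loops H e ≡ true → α e ≡ true × src H e ≡ tgt H e
  loop-in-α {e} α-loop = let αe , loop = ∧-true⇒ {α e} α-loop in αe , ==-true⇒≡ loop

  star-other : ∀ {x} → x ≢ v → ∀ e → δv (split H v α) (inject₁ x) e ≡ δv H x e
  star-other {x} x≢v e with α e ∧ loops H e in α-loop
  ... | true = begin
    (inject₁ v == inject₁ x) xor (fromℕ n == inject₁ x)
      ≡⟨ cong₂ _xor_ (trans (inject₁-== v x) (≢⇒==-false (x≢v ∘ sym))) (fromℕ-==-inject₁ x) ⟩
    false
      ≡⟨ δ-loop H (_== x) (proj₂ (loop-in-α α-loop)) ⟨
    δv H x e ∎
  ... | false = cong₂ _xor_ (stays (src H e)) (stays (tgt H e))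
    where
    stays : ∀ y → relocate (moved y e) y == inject₁ x ≡ y == x
    stays y with y ≟ x
    ... | yes refl rewrite ≢⇒==-false x≢v = ==-refl (inject₁ x)
    ... | no y≢x = trans (relocate-==-inject₁ (moved y e) y x)
                         (trans (cong (not (moved y e) ∧_) (≢⇒==-false y≢x)) (∧-zeroʳ _))

  module _ (adm : Admissible H v α) where
    α-star : ∀ e → α e ∧ loops H e ≡ false → α e ≡ true → δv H v e ≡ true
    α-star e α-loop αe with adm e αe
    ... | inj₁ star = star
    ... | inj₂ loop = contradiction (trans (sym α-loop) (cong₂ _∧_ αe loop)) λ ()

    star-minus : ∀ e → δv (split H v α) (inject₁ v) e ≡ α e
    star-minus e with α e ∧ loops H e in α-loop
    ... | true = trans (cong₂ _xor_ (==-refl (inject₁ v)) (fromℕ-==-inject₁ v)) (sym (proj₁ (loop-in-α α-loop)))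
    ... | false = trans (cong₂ _xor_ (relocate-==-inject₁ (moved (src H e) e) (src H e) v)
                                     (relocate-==-inject₁ (moved (tgt H e) e) (tgt H e) v))
                        (minus-parity (src H e == v) (tgt H e == v) (α e) (α-star e α-loop))
      where
      minus-parity : ∀ sv tv a → (a ≡ true → sv xor tv ≡ true) →
        (not (sv ∧ (sv xor tv) ∧ not a) ∧ sv) xor (not (tv ∧ (sv xor tv) ∧ not a) ∧ tv) ≡ a
      minus-parity false false false _ = refl
      minus-parity false false true  h = contradiction (h refl) λ ()
      minus-parity false true  false _ = refl
      minus-parity false true  true  _ = refl
      minus-parity true  false false _ = refl
      minus-parity true  false true  _ = refl
      minus-parity true  true  false _ = refl
      minus-parity true  true  true  h = contradiction (h refl) λ ()

    star-plus : ∀ e → δv (split H v α) (fromℕ n) e ≡ α e xor δv H v e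
    star-plus e with α e ∧ loops H e in α-loop
    ... | true = let αe , loop = loop-in-α α-loop in
      trans (cong₂ _xor_ (inject₁-==-fromℕ v) (==-refl (fromℕ n)))
            (sym (cong₂ _xor_ αe (δ-loop H (_== v) loop)))
    ... | false = trans (cong₂ _xor_ (relocate-==-fromℕ (moved (src H e) e) (src H e))
                                     (relocate-==-fromℕ (moved (tgt H e) e) (tgt H e)))
                        (plus-parity (src H e == v) (tgt H e == v) (α e) (α-star e α-loop))
      where
      plus-parity : ∀ sv tv a → (a ≡ true → sv xor tv ≡ true) →
        (sv ∧ (sv xor tv) ∧ not a) xor (tv ∧ (sv xor tv) ∧ not a) ≡ a xor (sv xor tv)
      plus-parity false false false _ = refl
      plus-parity false false true  h = contradiction (h refl) λ ()
      plus-parity false true  false _ = refl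
      plus-parity false true  true  _ = refl
      plus-parity true  false false _ = refl
      plus-parity true  false true  _ = refl
      plus-parity true  true  false _ = refl
      plus-parity true  true  true  h = contradiction (h refl) λ ()

    split-cycle : ∀ C → Cycle (split H v α) C ⇔ (Cycle H C × C · α ≡ false)
    split-cycle C = mk⇔ (λ cyc → restrict cyc , α-even cyc) extend
      where
      v⁺-parity : C · δv (split H v α) (fromℕ n) ≡ C · α xor C · δv H v
      v⁺-parity = trans (·-congʳ C star-plus) (·-distribʳ-△ C α (δv H v))
      α-even : Cycle (split H v α) C → C · α ≡ false
      α-even cyc = trans (sym (·-congʳ C star-minus)) (cyc (inject₁ v))
      restrict : Cycle (split H v α) C → Cycle H C
      restrict cyc x with x ≟ v
      ... | yes refl = trans (sym (cong (_xor C · δv H v) (α-even cyc))) (trans (sym v⁺-parity) (cyc (fromℕ n)))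
      ... | no x≢v = trans (sym (·-congʳ C (star-other x≢v))) (cyc (inject₁ x))
      extend : Cycle H C × C · α ≡ false → Cycle (split H v α) C
      extend (cyc , even) y with view y
      ... | ‵fromℕ = trans v⁺-parity (cong₂ _xor_ even (cyc v))
      ... | ‵inj₁ {i = x} _ with x ≟ v
      ...   | yes refl = trans (·-congʳ C star-minus) even
      ...   | no x≢v = trans (·-congʳ C (star-other x≢v)) (cyc x)

  split-keeps-loop : ∀ {e} → α e ≡ false → loops H e ≡ true → loops (split H v α) e ≡ true
  split-keeps-loop {e} αe loop rewrite αe | ==-true⇒≡ loop = ==-refl _

open Splitting using (split-cycle; star-other; split-keeps-loop)

split-admissible : ∀ {n m} {H : Graph n m} {v w α β} → Admissible H w β → v ≢ w →
  (∀ e → (α ∩ (β ∩ loops H)) e ≡ false) → Admissible (split H v α) (inject₁ w) β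
split-admissible {H = H} {v} {w} {α} {β} adm-β v≢w disjoint e βe with adm-β e βe
... | inj₁ w-star = inj₁ (trans (star-other H v α (v≢w ∘ sym) e) w-star)
... | inj₂ loop = inj₂ (split-keeps-loop H v α αe loop)
  where
  αe : α e ≡ false
  αe = trans (sym (∧-identityʳ (α e))) (trans (cong (α e ∧_) (sym (cong₂ _∧_ βe loop))) (disjoint e))

CycleEvenOn : ∀ {n m} → Graph n m → EdgeSet m → EdgeSet m → EdgeSet m → Set
CycleEvenOn H α β C = Cycle H C × C · α ≡ false × C · β ≡ false

unfold-cycle : ∀ {n m} {H : Graph n m} {v w α β} → Admissible H v α → Admissible H w β → v ≢ w →
  (∀ e → (α ∩ (β ∩ loops H)) e ≡ false) →
  ∀ C → Cycle (unfold H v w α β) C ⇔ CycleEvenOn H α β C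
unfold-cycle {H = H} {v} {w} {α} {β} adm-α adm-β v≢w disjoint C = mk⇔
  (λ cyc → let cyc₁ , β-even = to split-w cyc ; cyc₀ , α-even = to split-v cyc₁ in cyc₀ , α-even , β-even)
  (λ (cyc₀ , α-even , β-even) → from split-w (from split-v (cyc₀ , α-even) , β-even))
  where
  split-v : Cycle (split H v α) C ⇔ (Cycle H C × C · α ≡ false)
  split-v = split-cycle H v α adm-α C
  split-w : Cycle (unfold H v w α β) C ⇔ (Cycle (split H v α) C × C · β ≡ false)
  split-w = split-cycle (split H v α) (inject₁ w) β (split-admissible {α = α} adm-β v≢w disjoint) C

G₁-cycle : ∀ {m} (T : QuadTemplate m) C → Cycle (G₁ T) C ⇔ CycleEvenOn (H₁ T) (α₁ T) (β₁ T) C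
G₁-cycle T = unfold-cycle (α₁-ok T) (β₁-ok T) (v₁≢w₁ T) (αβ₁-loops T)

G₂-cycle : ∀ {m} (T : QuadTemplate m) C → Cycle (G₂ T) C ⇔ CycleEvenOn (H₂ T) (α₂ T) (β₂ T) C
G₂-cycle T = unfold-cycle (α₂-ok T) (β₂-ok T) (v₂≢w₂ T) (αβ₂-loops T)

-- The cuts comparing α, β with α', β' may live in any K with the cycles of H; for G₂ it is H₁.
unfold-equivalent : ∀ {k n n' p p' m} {K : Graph k m} {H : Graph n m} {H' : Graph n' m}
  {G : Graph p m} {G' : Graph p' m} {α β α' β' : EdgeSet m} →
  GEquiv K H → GEquiv H H' → IsCut K (α △ α') → IsCut K (β △ β') →
  (∀ C → Cycle G C ⇔ CycleEvenOn H α β C) → (∀ C → Cycle G' C ⇔ CycleEvenOn H' α' β' C) →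
  GEquiv G G'
unfold-equivalent {K = K} {H} {H'} {α = α} {β} {α'} {β'} K≈H H≈H' α-cut β-cut G-cycle G'-cycle =
  Cycle⇔⇒GEquiv (λ C → ⇔-sym (G'-cycle C) ⇔-∘ (mk⇔ forward backward ⇔-∘ G-cycle C))
  where
  same-parities : ∀ {C} → Cycle H C → C · α ≡ C · α' × C · β ≡ C · β'
  same-parities {C} cyc = cut-parity-invariant K α-cut cycK , cut-parity-invariant K β-cut cycK
    where
    cycK : Cycle K C
    cycK = from (Cycle⇔ K≈H C) cyc
  forward : ∀ {C} → CycleEvenOn H α β C → CycleEvenOn H' α' β' C
  forward {C} (cyc , α-even , β-even) = let α≡ , β≡ = same-parities cyc in
    to (Cycle⇔ H≈H' C) cyc , trans (sym α≡) α-even , trans (sym β≡) β-even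
  backward : ∀ {C} → CycleEvenOn H' α' β' C → CycleEvenOn H α β C
  backward {C} (cyc' , α-even , β-even) =
    let cyc = from (Cycle⇔ H≈H' C) cyc' ; α≡ , β≡ = same-parities cyc in
    cyc , trans α≡ α-even , trans β≡ β-even

SameEcycle-sym : ∀ {n n' m} {G : Graph n m} {G' : Graph n' m} {Σ Σ'} →
  SameEcycle G Σ G' Σ' → SameEcycle G' Σ' G Σ
SameEcycle-sym same C = ⇔-sym (same C)

even-cycle-transfer : ∀ {n n' m} {G : Graph n m} {G' : Graph n' m} {Σ Σ' C} →
  SameEcycle G Σ G' Σ' → Cycle G C → C · Σ ≡ false → Cycle G' C × C · Σ' ≡ false
even-cycle-transfer {G = G} {G'} {Σ} {Σ'} {C} same cyc even =
  let cyc' , even' = to (same C) (from (IsCycle⇔Cycle G C) cyc , from (Even-count⇔ (C ∩ Σ)) even)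
  in to (IsCycle⇔Cycle G' C) cyc' , to (Even-count⇔ (C ∩ Σ')) even'

-- A Σ-odd cycle D of G becomes Σ-even after adding the Σ-odd common cycle C.
odd-common-cycle⇒cycles⊆ : ∀ {n n' m} {G : Graph n m} {G' : Graph n' m} {Σ Σ' C} →
  SameEcycle G Σ G' Σ' → Cycle G C → Cycle G' C → C · Σ ≡ true → ∀ D → Cycle G D → Cycle G' D
odd-common-cycle⇒cycles⊆ {G = G} {G'} {Σ} {C = C} same cycC cycC' C-odd D cycD with D · Σ in D-parity
... | false = proj₁ (even-cycle-transfer {G = G} {G'} same cycD D-parity)
... | true = Cycle-cong G' (λ e → xor-cancelʳ (D e) (C e)) (Cycle-△ G' cycDC' cycC')
  where
  cycDC' : Cycle G' (D △ C)
  cycDC' = proj₁ (even-cycle-transfer {G = G} {G'} same (Cycle-△ G cycD cycC)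
                                      (trans (·-distribˡ-△ D C Σ) (cong₂ _xor_ D-parity C-odd)))

even-cycle-parity : ∀ {n n' m} {G : Graph n m} {G' : Graph n' m} {Σ Σ' C} →
  SameEcycle G Σ G' Σ' → ¬ GEquiv G G' → Cycle G C → (C · Σ ≡ false ⇔ Cycle G' C)
even-cycle-parity {G = G} {G'} {Σ} {Σ'} {C} same G≉G' cyc =
  mk⇔ (proj₁ ∘ even-cycle-transfer {G = G} {G'} same cyc) even
  where
  even : Cycle G' C → C · Σ ≡ false
  even cyc' with C · Σ in parity | C · Σ' in parity'
  ... | false | _ = refl
  ... | true | false = contradiction
    (trans (sym parity) (proj₂ (even-cycle-transfer {G = G'} {G} (SameEcycle-sym same) cyc' parity'))) λ ()
  ... | true | true = contradiction (Cycle⇔⇒GEquiv λ D → mk⇔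
    (odd-common-cycle⇒cycles⊆ {G = G} {G'} same cyc cyc' parity D)
    (odd-common-cycle⇒cycles⊆ {G = G'} {G} (SameEcycle-sym same) cyc' cyc parity' D)) G≉G'

signature-cut : ∀ {n₁ n₂ n₁' n₂' m} {G₁ : Graph n₁ m} {G₂ : Graph n₂ m}
  {G₁' : Graph n₁' m} {G₂' : Graph n₂' m} {Σ₁ Σ₂ Σ₁' Σ₂'} →
  SameEcycle G₁ Σ₁ G₂ Σ₂ → ¬ GEquiv G₁ G₂ →
  SameEcycle G₁' Σ₁' G₂' Σ₂' → ¬ GEquiv G₁' G₂' →
  GEquiv G₁ G₁' → GEquiv G₂ G₂' → IsCut G₁ (Σ₁ △ Σ₁')
signature-cut {G₁ = G₁} {Σ₁ = Σ₁} {Σ₁' = Σ₁'} same G₁≉G₂ same' G₁'≉G₂' G₁≈G₁' G₂≈G₂' =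
  orthogonal⇒cut G₁ (Σ₁ △ Σ₁') λ C cyc →
    trans (·-distribʳ-△ C Σ₁ Σ₁') (≡⇒xor-false (false⇔false⇒≡ (Σ₁-even⇔Σ₁'-even cyc)))
  where
  Σ₁-even⇔Σ₁'-even : ∀ {C} → Cycle G₁ C → (C · Σ₁ ≡ false ⇔ C · Σ₁' ≡ false)
  Σ₁-even⇔Σ₁'-even {C} cyc =
    ⇔-sym (even-cycle-parity same' G₁'≉G₂' (to (Cycle⇔ G₁≈G₁' C) cyc))
      ⇔-∘ (Cycle⇔ G₂≈G₂' C ⇔-∘ even-cycle-parity same G₁≉G₂ cyc)

lemma9 : ∀ {m} (T T' : QuadTemplate m) → Compatible T T'
    → (Σ₁ Σ₂ Σ₁' Σ₂' : EdgeSet m)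
    → QuadSiblings T Σ₁ Σ₂ → QuadSiblings T' Σ₁' Σ₂'
    → SEquiv (G₁ T) Σ₁ (G₁ T') Σ₁' × SEquiv (G₂ T) Σ₂ (G₂ T') Σ₂'
lemma9 T T' (H₁≈H₁' , H₂≈H₂' , α₁-cut , β₁-cut , α₂-cut , β₂-cut) Σ₁ Σ₂ Σ₁' Σ₂' sib sib' =
  (G₁≈G₁' , signature-cut sib (inequiv T) sib' (inequiv T') G₁≈G₁' G₂≈G₂') ,
  (G₂≈G₂' , signature-cut (SameEcycle-sym sib) (inequiv T ∘ GEquiv-sym)
                          (SameEcycle-sym sib') (inequiv T' ∘ GEquiv-sym) G₂≈G₂' G₁≈G₁')
  where
  G₁≈G₁' : GEquiv (G₁ T) (G₁ T')
  G₁≈G₁' = unfold-equivalent GEquiv-refl H₁≈H₁' α₁-cut β₁-cut (G₁-cycle T) (G₁-cycle T')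
  G₂≈G₂' : GEquiv (G₂ T) (G₂ T')
  G₂≈G₂' = unfold-equivalent (H₁≈H₂ T) H₂≈H₂' α₂-cut β₂-cut (G₂-cycle T) (G₂-cycle T')
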